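{- Let $k$ be a positive integer. In any graph $G$, every vertex belonging to an edge resolving set of $G$ of size $k$ has degree at most $2^{k-1}$. Moreover, this bound is sharp: for every positive integer $k$ there exist a graph $G$ and an edge resolving set of $G$ of size $k$ containing a vertex of degree $2^{k-1}$.
   Context: Graphs are finite, simple, undirected, possibly disconnected. For an edge $e=\{u,v\}$ and vertex $w$, $\textnormal{dist}(e,w)=\min(\textnormal{dist}(w,u),\textnormal{dist}(w,v))$. A set $S=\{v_1,\dots,v_k\}$ of vertices is an edge resolving set of $G$ if the vectors $(\textnormal{dist}(e,v_1),\dots,\textnormal{dist}(e,v_k))$ are pairwise distinct over all edges $e$. -}

module Defs where

open import Data.Bool using (Bool; true; false; _∧_; _∨_; if_then_else_)
open import Data.Nat using (ℕ; zero; suc; _≤_; _^_; _∸_; _⊓_)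
open import Data.Fin using (Fin; _≟_)
open import Relation.Nullary using (does)
open import Data.List using (List; allFin; filterᵇ; length)
open import Data.Bool.ListAction using (any)
open import Data.Maybe using (Maybe; just; nothing)
open import Data.Product using (_×_)
open import Data.Sum using (_⊎_)
open import Relation.Binary.PropositionalEquality using (_≡_)

record Graph : Set where
  field
    n     : ℕ
    adj   : Fin n → Fin n → Bool
    sym   : ∀ u v → adj u v ≡ adj v u
    irrefl : ∀ v → adj v v ≡ false

open Graph public

reach : (G : Graph) → ℕ → Fin (n G) → Fin (n G) → Bool
reach G zero u v = does (u ≟ v)
reach G (suc d) u v =
  reach G d u v ∨ any (λ w → reach G d u w ∧ adj G w v) (allFin (n G))

-- Extended naturals: nothing = ∞ (different components).
ℕ∞ : Set
ℕ∞ = Maybe ℕ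

findDist : (G : Graph) → Fin (n G) → Fin (n G) → (fuel start : ℕ) → ℕ∞
findDist G u v zero start = nothing
findDist G u v (suc fuel) start =
  if reach G start u v then just start else findDist G u v fuel (suc start)

-- Graph distance dist(u,v) (shortest paths have length < n; ∞ if unreachable).
dist : (G : Graph) → Fin (n G) → Fin (n G) → ℕ∞
dist G u v = findDist G u v (suc (n G)) 0

min∞ : ℕ∞ → ℕ∞ → ℕ∞
min∞ nothing y = y
min∞ (just x) nothing = just x
min∞ (just x) (just y) = just (x ⊓ y)

edgeDist : (G : Graph) → Fin (n G) → Fin (n G) → Fin (n G) → ℕ∞
edgeDist G u v w = min∞ (dist G w u) (dist G w v)

-- S : Fin k → vertices, an injective enumeration of the set {v_1,…,v_k}.
-- S is edge resolving: distinct edges have distinct distance vectors.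
IsEdgeResolving : (G : Graph) {k : ℕ} → (Fin k → Fin (n G)) → Set
IsEdgeResolving G S =
  ∀ u v u' v' → adj G u v ≡ true → adj G u' v' ≡ true →
  (∀ i → edgeDist G u v (S i) ≡ edgeDist G u' v' (S i)) →
  (u ≡ u' × v ≡ v') ⊎ (u ≡ v' × v ≡ u')

degree : (G : Graph) → Fin (n G) → ℕ
degree G v = length (filterᵇ (adj G v) (allFin (n G)))

-- Let s belong to an edge resolving set S of size k. For a neighbour x of s and a landmark
-- w ≠ s, the edge sx lies at distance d(w,s) or d(w,s) − 1 from w, and at distance 0 from s.
-- So edges at s are told apart by k − 1 bits, and s has at most 2^(k−1) neighbours.
-- Sharpness: join a centre to 2^(k−1) vertices, one per subset of a set of k − 1 element
-- vertices, and each of those to the elements of its subset. The centre and the elements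
-- resolve the edges: the centre separates spokes from the other edges, the element at
-- distance 0 names the element of a subset–element edge, and the elements adjacent to
-- the edge recover the subset.
module Submission where

open import Defs hiding (sym)
import Defs
open import Data.Bool using (Bool; true; false; _∧_; _∨_; T?)
open import Data.Bool.ListAction using (any)
open import Data.Bool.Properties using (T-≡; ∨-zeroʳ; ∨-comm; ∨-identityʳ)
import Data.Bool.Properties as Bool
open import Data.Empty using (⊥-elim)
open import Data.Fin using (Fin; zero; suc; _≟_; punchIn; punchOut; splitAt; join; _↑ˡ_; _↑ʳ_)
open import Data.Fin.Properties using (punchIn-punchOut; nonZeroIndex; join-splitAt; splitAt-↑ˡ; splitAt-↑ʳ)
open import Data.List using (List; []; _∷_; allFin; filter; filterᵇ; length; tabulate)
open import Data.List.Membership.Propositional using (_∈_)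
open import Data.List.Membership.Propositional.Properties using (∈-allFin; ∈-filter⁻)
open import Data.List.Relation.Unary.All using (_∷_)
open import Data.List.Relation.Unary.AllPairs using (_∷_)
open import Data.List.Relation.Unary.Any using (here; there)
import Data.List.Relation.Unary.Any as Any
open import Data.List.Relation.Unary.Any.Properties using (any⁺)
open import Data.List.Relation.Unary.Unique.Propositional using (Unique)
import Data.List.Relation.Unary.Unique.Propositional.Properties as Unique
open import Data.Maybe using (just; nothing)
import Data.Maybe.Properties as Maybe
open import Data.Nat using (ℕ; zero; suc; NonZero; _≤_; _<_; _+_; _∸_; _^_; _⊓_; z≤n; s≤s; s≤s⁻¹)
open import Data.Nat.Properties hiding (_≟_)
import Data.Nat.Properties as ℕ
open import Data.Product using (Σ; ∃; _×_; _,_; proj₂)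
open import Data.Sum using (_⊎_; inj₁; inj₂; [_,_]′; reduce)
import Data.Sum as Sum
open import Function using (_∘_; const)
open import Function.Bundles using (Equivalence; mk⇔)
open import Function.Definitions using (Injective)
open import Relation.Binary.Definitions using (DecidableEquality)
open import Relation.Binary.PropositionalEquality
open import Relation.Nullary using (Dec; does; yes; no)
open import Relation.Nullary.Decidable using (map′; does-⇔; dec-true; dec-false)

any-∈ : ∀ {A : Set} (p : A → Bool) {x xs} → x ∈ xs → p x ≡ true → any p xs ≡ true
any-∈ p x∈xs px =
  Equivalence.to T-≡ (any⁺ p (Any.map (λ { refl → Equivalence.from T-≡ px }) x∈xs))

any-false : ∀ {A : Set} (p : A → Bool) xs → (∀ x → p x ≡ false) → any p xs ≡ false
any-false p []       _   = refl
any-false p (x ∷ xs) p≡f rewrite p≡f x = any-false p xs p≡f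

module _ (G : Graph) where

  findDist-sound : ∀ {u v f st d} → findDist G u v f st ≡ just d →
                   reach G d u v ≡ true × st ≤ d × d < st + f
  findDist-sound {u} {v} {suc f} {st} eq with reach G st u v in r
  findDist-sound {f = suc f} {st} refl | true =
    r , ≤-refl , ≤-trans (s≤s (m≤m+n st f)) (≤-reflexive (sym (+-suc st f)))
  ... | false with findDist-sound eq
  ... | r′ , st<d , d< = r′ , <⇒≤ st<d , ≤-trans d< (≤-reflexive (sym (+-suc st f)))

  findDist-complete : ∀ {u v f st d} → st ≤ d → d < st + f → reach G d u v ≡ true →
                      ∃ λ a → findDist G u v f st ≡ just a × a ≤ d
  findDist-complete {f = zero} {st} st≤d d<st r =
    ⊥-elim (<-irrefl refl (≤-trans d<st (≤-trans (≤-reflexive (+-identityʳ st)) st≤d)))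
  findDist-complete {u} {v} {suc f} {st} st≤d d< r with reach G st u v in r′
  ... | true = st , refl , st≤d
  ... | false with m≤n⇒m<n∨m≡n st≤d
  ... | inj₁ st<d = findDist-complete st<d (≤-trans d< (≤-reflexive (+-suc st f))) r
  ... | inj₂ refl with () ← trans (sym r′) r

  dist-sound : ∀ {w u d} → dist G w u ≡ just d → reach G d w u ≡ true × d ≤ n G
  dist-sound eq with findDist-sound {f = suc (n G)} {st = 0} eq
  ... | r , _ , d<1+n = r , s≤s⁻¹ d<1+n

  dist-complete : ∀ {w u d} → reach G d w u ≡ true → d ≤ n G →
                  ∃ λ a → dist G w u ≡ just a × a ≤ d
  dist-complete r d≤n = findDist-complete z≤n (s≤s d≤n) r

  reach-suc : ∀ {d w x s} → reach G d w x ≡ true → adj G x s ≡ true →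
              reach G (suc d) w s ≡ true
  reach-suc {d} {w} {x} {s} r a =
    trans (cong (reach G d w s ∨_) (any-∈ _ (∈-allFin x) (cong₂ _∧_ r a))) (∨-zeroʳ _)

  dist-neighbour : ∀ {w x s d} → adj G x s ≡ true → dist G w x ≡ just d →
                   (∃ λ a → dist G w s ≡ just a × a ≤ suc d) ⊎ (dist G w s ≡ nothing × d ≡ n G)
  dist-neighbour {w} {x} {s} {d} x~s dx with dist-sound dx
  ... | r , d≤n with dist G w s in ds
  ... | just a = inj₁ (a , refl , a≤1+d)
    where
    a≤1+d : a ≤ suc d
    a≤1+d with m≤n⇒m<n∨m≡n d≤n
    ... | inj₂ refl = m≤n⇒m≤1+n (proj₂ (dist-sound ds))
    ... | inj₁ d<n with dist-complete (reach-suc {d} {w} r x~s) d<n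
    ...   | _ , ds′ , ≤1+d with refl ← trans (sym ds) ds′ = ≤1+d
  ... | nothing with m≤n⇒m<n∨m≡n d≤n
  ...   | inj₂ d≡n = inj₂ (refl , d≡n)
  ...   | inj₁ d<n with dist-complete (reach-suc {d} {w} r x~s) d<n
  ...     | _ , ds′ , _ with () ← trans (sym ds) ds′

-- pred∞ N ∞ = N covers a neighbour x of s at distance N = n G from w while s lies beyond
-- the search range of dist; this never happens, but ruling it out would need shortest walks
-- to be shorter than n G.
pred∞ : ℕ → ℕ∞ → ℕ∞
pred∞ N (just a) = just (a ∸ 1)
pred∞ N nothing  = just N

⊓-pred-or-self : ∀ {a d} → a ≤ suc d → a ⊓ d ≡ a ⊎ a ⊓ d ≡ a ∸ 1
⊓-pred-or-self {a} {d} a≤1+d with a ≤? d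
... | yes a≤d = inj₁ (m≤n⇒m⊓n≡m a≤d)
... | no a≰d with refl ← ≤-antisym a≤1+d (≰⇒> a≰d) = inj₂ (m≥n⇒m⊓n≡n (n≤1+n d))

min∞-nothingʳ : ∀ a → min∞ a nothing ≡ a
min∞-nothingʳ nothing  = refl
min∞-nothingʳ (just a) = refl

edgeDist-neighbour : ∀ G {w x s} → adj G x s ≡ true →
                     edgeDist G s x w ≡ dist G w s ⊎ edgeDist G s x w ≡ pred∞ (n G) (dist G w s)
edgeDist-neighbour G {w} {x} {s} x~s with dist G w x in dx
... | nothing = inj₁ (min∞-nothingʳ _)
... | just d with dist-neighbour G x~s dx
...   | inj₂ (ds , refl) rewrite ds = inj₂ refl
...   | inj₁ (a , ds , a≤1+d) rewrite ds =
  Sum.map (cong just) (cong just) (⊓-pred-or-self a≤1+d)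

dist-refl : ∀ G s → dist G s s ≡ just 0
dist-refl G s rewrite dec-true (s ≟ s) refl = refl

edgeDist-endpoint : ∀ G s x → edgeDist G s x s ≡ just 0
edgeDist-endpoint G s x rewrite dist-refl G s with dist G s x
... | nothing = refl
... | just _  = refl

two-valued-≡ : ∀ {A : Set} (_≟_ : DecidableEquality A) {v v′ a b : A} →
               v ≡ a ⊎ v ≡ b → v′ ≡ a ⊎ v′ ≡ b → does (v ≟ a) ≡ does (v′ ≟ a) → v ≡ v′
two-valued-≡ _≟_ {v} {v′} {a} v∈ v′∈ same with v ≟ a | v′ ≟ a
... | yes v≡a | yes v′≡a = trans v≡a (sym v′≡a)
... | no v≢a  | no v′≢a with v∈ | v′∈
...   | inj₁ v≡a | _         = ⊥-elim (v≢a v≡a)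
...   | _        | inj₁ v′≡a = ⊥-elim (v′≢a v′≡a)
...   | inj₂ v≡b | inj₂ v′≡b = trans v≡b (sym v′≡b)

_≟∞_ : DecidableEquality ℕ∞
_≟∞_ = Maybe.≡-dec ℕ._≟_

InjectiveOn : ∀ {A : Set} {m} → List A → (A → Fin m → Bool) → Set
InjectiveOn xs code = ∀ {x y} → x ∈ xs → y ∈ xs → code x ≗ code y → x ≡ y

length-by-value : ∀ {A : Set} (p : A → Bool) xs →
                  length xs ≡ length (filter (λ x → p x Bool.≟ true) xs)
                             + length (filter (λ x → p x Bool.≟ false) xs)
length-by-value p []       = refl
length-by-value p (x ∷ xs) with p x
... | true  = cong suc (length-by-value p xs)
... | false = trans (cong suc (length-by-value p xs)) (sym (+-suc _ _))

length≤2^ : ∀ {A : Set} m (code : A → Fin m → Bool) xs →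
            Unique xs → InjectiveOn xs code → length xs ≤ 2 ^ m
length≤2^ zero code []      _ _ = z≤n
length≤2^ zero code (_ ∷ []) _ _ = ≤-refl
length≤2^ zero code (_ ∷ _ ∷ _) ((x≢y ∷ _) ∷ _) inj =
  ⊥-elim (x≢y (inj (here refl) (there (here refl)) λ ()))
length≤2^ (suc m) code xs unique inj = begin
  length xs                                   ≡⟨ length-by-value first xs ⟩
  length (class true) + length (class false)  ≤⟨ +-mono-≤ (class-bound true) (class-bound false) ⟩
  2 ^ m + 2 ^ m                               ≡⟨ cong (2 ^ m +_) (sym (+-identityʳ _)) ⟩
  2 ^ suc m                                   ∎
  where
  open ≤-Reasoning
  first : _ → Bool
  first x = code x zero
  hasFirst : ∀ b x → Dec (first x ≡ b)
  hasFirst b x = first x Bool.≟ b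
  class : Bool → List _
  class b = filter (hasFirst b) xs
  class-bound : ∀ b → length (class b) ≤ 2 ^ m
  class-bound b = length≤2^ m (λ x → code x ∘ suc) (class b) (Unique.filter⁺ _ unique) inj′
    where
    inj′ : InjectiveOn (class b) (λ x → code x ∘ suc)
    inj′ x∈ y∈ same with ∈-filter⁻ (hasFirst b) x∈ | ∈-filter⁻ (hasFirst b) y∈
    ... | x∈xs , refl | y∈xs , fy≡b = inj x∈xs y∈xs λ { zero → sym fy≡b ; (suc j) → same j }

neighbours : ∀ G → Fin (n G) → List (Fin (n G))
neighbours G s = filterᵇ (adj G s) (allFin (n G))

∈-neighbours⁻ : ∀ G {s x} → x ∈ neighbours G s → adj G s x ≡ true
∈-neighbours⁻ G {s} x∈ =
  Equivalence.to T-≡ (proj₂ (∈-filter⁻ (T? ∘ adj G s) {xs = allFin (n G)} x∈))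

neighbours-unique : ∀ G s → Unique (neighbours G s)
neighbours-unique G s = Unique.filter⁺ _ (Unique.allFin⁺ (n G))

degree≤2^ : ∀ G {m} (S : Fin (suc m) → Fin (n G)) → IsEdgeResolving G S →
            ∀ i → degree G (S i) ≤ 2 ^ m
degree≤2^ G {m} S resolving i =
  length≤2^ m code (neighbours G s) (neighbours-unique G s) code-injective
  where
  s = S i
  other : Fin m → Fin (n G)
  other j = S (punchIn i j)
  s~ : ∀ {x} → x ∈ neighbours G s → adj G s x ≡ true
  s~ = ∈-neighbours⁻ G
  code : Fin (n G) → Fin m → Bool
  code x j = does (edgeDist G s x (other j) ≟∞ dist G (other j) s)

  same-vector : ∀ {x y} → adj G s x ≡ true → adj G s y ≡ true → code x ≗ code y →
                ∀ j → edgeDist G s x (S j) ≡ edgeDist G s y (S j)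
  same-vector {x} {y} s~x s~y same j with i ≟ j
  ... | yes refl = trans (edgeDist-endpoint G s x) (sym (edgeDist-endpoint G s y))
  ... | no i≢j rewrite sym (punchIn-punchOut i≢j) =
    two-valued-≡ _≟∞_ (edgeDist-neighbour G (trans (Defs.sym G x s) s~x))
                      (edgeDist-neighbour G (trans (Defs.sym G y s) s~y)) (same (punchOut i≢j))

  code-injective : InjectiveOn (neighbours G s) code
  code-injective x∈ y∈ same
    with resolving s _ s _ (s~ x∈) (s~ y∈) (same-vector (s~ x∈) (s~ y∈) same)
  ... | inj₁ (_ , x≡y) = x≡y
  ... | inj₂ (refl , _) with () ← trans (sym (s~ y∈)) (irrefl G s)

-- Distance up to 0, 1, ≥ 2 (including ∞): coarse enough to be read off equality and
-- adjacency, fine enough to resolve the edges of the extremal graph below.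
data Proximity : Set where
  at beside far : Proximity

proximity : ℕ∞ → Proximity
proximity (just 0) = at
proximity (just 1) = beside
proximity _        = far

proximityOf : (equal adjacent : Bool) → Proximity
proximityOf true  _     = at
proximityOf false true  = beside
proximityOf false false = far

closer : Proximity → Proximity → Proximity
closer at     _      = at
closer beside at     = at
closer beside _      = beside
closer far    q      = q

proximity-min∞ : ∀ a b → proximity (min∞ a b) ≡ closer (proximity a) (proximity b)
proximity-min∞ nothing                  b                        = refl
proximity-min∞ (just zero)              nothing                  = refl
proximity-min∞ (just (suc zero))        nothing                  = refl
proximity-min∞ (just (suc (suc a)))     nothing                  = refl
proximity-min∞ (just zero)              (just b)                 = refl
proximity-min∞ (just (suc zero))        (just zero)              = refl
proximity-min∞ (just (suc zero))        (just (suc zero))        = refl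
proximity-min∞ (just (suc zero))        (just (suc (suc b)))     = refl
proximity-min∞ (just (suc (suc a)))     (just zero)              = refl
proximity-min∞ (just (suc (suc a)))     (just (suc zero))        = refl
proximity-min∞ (just (suc (suc a)))     (just (suc (suc b)))     = refl

proximityOf-∨ : ∀ e a e′ a′ →
                proximityOf (e ∨ e′) (a ∨ a′) ≡ closer (proximityOf e a) (proximityOf e′ a′)
proximityOf-∨ true  a     e′    a′    = refl
proximityOf-∨ false true  true  a′    = refl
proximityOf-∨ false true  false true  = refl
proximityOf-∨ false true  false false = refl
proximityOf-∨ false false e′    a′    = refl

proximityOf-false-injective : ∀ {a a′} → proximityOf false a ≡ proximityOf false a′ → a ≡ a′
proximityOf-false-injective {true}  {true}  _ = refl
proximityOf-false-injective {false} {false} _ = refl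

proximityOf-at : ∀ {e a} → proximityOf e a ≡ at → e ≡ true
proximityOf-at {true}  _ = refl
proximityOf-at {false} {true}  ()
proximityOf-at {false} {false} ()

module _ (G : Graph) where

  reach-1 : ∀ w u → reach G 1 w u ≡ does (w ≟ u) ∨ adj G w u
  reach-1 w u = cong (does (w ≟ u) ∨_) (any-step (adj G w u) refl)
    where
    any-step : ∀ b → adj G w u ≡ b → any (λ z → does (w ≟ z) ∧ adj G z u) (allFin (n G)) ≡ b
    any-step true  w~u =
      any-∈ _ (∈-allFin w) (trans (cong (_∧ adj G w u) (dec-true (w ≟ w) refl)) w~u)
    any-step false w≁u = any-false _ (allFin (n G)) only-w
      where
      only-w : ∀ z → does (w ≟ z) ∧ adj G z u ≡ false
      only-w z with w ≟ z
      ... | yes refl = w≁u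
      ... | no _     = refl

  findDist-far : ∀ w u f d → proximity (findDist G w u f (suc (suc d))) ≡ far
  findDist-far w u zero    d = refl
  findDist-far w u (suc f) d with reach G (suc (suc d)) w u
  ... | true  = refl
  ... | false = findDist-far w u f (suc d)

  proximity-findDist : ∀ w u f → .{{NonZero f}} →
                       proximity (findDist G w u (suc f) 0) ≡ proximityOf (does (w ≟ u)) (adj G w u)
  proximity-findDist w u (suc f) rewrite reach-1 w u with does (w ≟ u) | adj G w u
  ... | true  | _     = refl
  ... | false | true  = refl
  ... | false | false = findDist-far w u f 0

  proximity-dist : ∀ w u → proximity (dist G w u) ≡ proximityOf (does (w ≟ u)) (adj G w u)
  proximity-dist w u = proximity-findDist w u (n G) {{nonZeroIndex w}}

  proximity-edgeDist : ∀ u v w → proximity (edgeDist G u v w) ≡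
                       proximityOf (does (w ≟ u) ∨ does (w ≟ v)) (adj G w u ∨ adj G w v)
  proximity-edgeDist u v w = begin
    proximity (min∞ (dist G w u) (dist G w v))
      ≡⟨ proximity-min∞ (dist G w u) (dist G w v) ⟩
    closer (proximity (dist G w u)) (proximity (dist G w v))
      ≡⟨ cong₂ closer (proximity-dist w u) (proximity-dist w v) ⟩
    closer (proximityOf (does (w ≟ u)) (adj G w u)) (proximityOf (does (w ≟ v)) (adj G w v))
      ≡⟨ sym (proximityOf-∨ (does (w ≟ u)) (adj G w u) (does (w ≟ v)) (adj G w v)) ⟩
    proximityOf (does (w ≟ u) ∨ does (w ≟ v)) (adj G w u ∨ adj G w v) ∎
    where open ≡-Reasoning

SameEnds : ∀ {A : Set} → A → A → A → A → Set
SameEnds a b a′ b′ = (a ≡ a′ × b ≡ b′) ⊎ (a ≡ b′ × b ≡ a′)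

SameEnds-sym : ∀ {A : Set} {a b a′ b′ : A} → SameEnds a b a′ b′ → SameEnds a′ b′ a b
SameEnds-sym (inj₁ (refl , refl)) = inj₁ (refl , refl)
SameEnds-sym (inj₂ (refl , refl)) = inj₂ (refl , refl)

SameEnds-trans : ∀ {A : Set} {a b c d e f : A} →
                 SameEnds a b c d → SameEnds c d e f → SameEnds a b e f
SameEnds-trans (inj₁ (refl , refl)) q                    = q
SameEnds-trans (inj₂ (refl , refl)) (inj₁ (refl , refl)) = inj₂ (refl , refl)
SameEnds-trans (inj₂ (refl , refl)) (inj₂ (refl , refl)) = inj₁ (refl , refl)

SameEnds-injective : ∀ {A B : Set} {f : A → B} → Injective _≡_ _≡_ f →
                     ∀ {a b a′ b′} → SameEnds (f a) (f b) (f a′) (f b′) → SameEnds a b a′ b′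
SameEnds-injective f-inj (inj₁ (p , q)) = inj₁ (f-inj p , f-inj q)
SameEnds-injective f-inj (inj₂ (p , q)) = inj₂ (f-inj p , f-inj q)

pow2 : ℕ → ℕ
pow2 zero    = 1
pow2 (suc m) = pow2 m + pow2 m

pow2≡2^ : ∀ m → pow2 m ≡ 2 ^ m
pow2≡2^ zero    = refl
pow2≡2^ (suc m) =
  trans (cong₂ _+_ (pow2≡2^ m) (pow2≡2^ m)) (cong (2 ^ m +_) (sym (+-identityʳ _)))

isInj₂ᵇ : ∀ {A B : Set} → A ⊎ B → Bool
isInj₂ᵇ = [ const false , const true ]′

reduce-injective : ∀ {A : Set} {s s′ : A ⊎ A} →
                   isInj₂ᵇ s ≡ isInj₂ᵇ s′ → reduce s ≡ reduce s′ → s ≡ s′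
reduce-injective {s = inj₁ _} {inj₁ _} _ refl = refl
reduce-injective {s = inj₂ _} {inj₂ _} _ refl = refl

splitAt-injective : ∀ m {n} {i j : Fin (m + n)} → splitAt m i ≡ splitAt m j → i ≡ j
splitAt-injective m {n} {i} {j} eq =
  trans (sym (join-splitAt m n i)) (trans (cong (join m n) eq) (join-splitAt m n j))

-- t : Fin (pow2 m) encodes a subset of Fin m, its binary digits read off the halves of splitAt.
bit : ∀ {m} → Fin (pow2 m) → Fin m → Bool
bit {suc m} t zero    = isInj₂ᵇ (splitAt (pow2 m) t)
bit {suc m} t (suc j) = bit (reduce (splitAt (pow2 m) t)) j

bit-injective : ∀ {m} {t t′ : Fin (pow2 m)} → (∀ (j : Fin m) → bit t j ≡ bit t′ j) → t ≡ t′
bit-injective {zero}  {zero} {zero} _ = refl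
bit-injective {suc m} same =
  splitAt-injective (pow2 m) (reduce-injective (same zero) (bit-injective {m} (same ∘ suc)))

data Vertex (m : ℕ) : Set where
  centre  : Vertex m
  subset  : Fin (pow2 m) → Vertex m
  element : Fin m → Vertex m

subset-injective : ∀ {m} {t t′ : Fin (pow2 m)} → subset {m} t ≡ subset t′ → t ≡ t′
subset-injective refl = refl

element-injective : ∀ {m} {j j′ : Fin m} → element {m} j ≡ element j′ → j ≡ j′
element-injective refl = refl

_≟ⱽ_ : ∀ {m} → DecidableEquality (Vertex m)
centre    ≟ⱽ centre     = yes refl
subset t  ≟ⱽ subset t′  = map′ (cong subset) subset-injective (t ≟ t′)
element j ≟ⱽ element j′ = map′ (cong element) element-injective (j ≟ j′)
centre    ≟ⱽ subset _   = no λ ()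
centre    ≟ⱽ element _  = no λ ()
subset _  ≟ⱽ centre     = no λ ()
subset _  ≟ⱽ element _  = no λ ()
element _ ≟ⱽ centre     = no λ ()
element _ ≟ⱽ subset _   = no λ ()

adjacent : ∀ {m} → Vertex m → Vertex m → Bool
adjacent centre      (subset _)  = true
adjacent (subset _)  centre      = true
adjacent (subset t)  (element j) = bit t j
adjacent (element j) (subset t)  = bit t j
adjacent _           _           = false

adjacent-sym : ∀ {m} (a b : Vertex m) → adjacent a b ≡ adjacent b a
adjacent-sym centre      centre      = refl
adjacent-sym centre      (subset _)  = refl
adjacent-sym centre      (element _) = refl
adjacent-sym (subset _)  centre      = refl
adjacent-sym (subset _)  (subset _)  = refl
adjacent-sym (subset _)  (element _) = refl
adjacent-sym (element _) centre      = refl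
adjacent-sym (element _) (subset _)  = refl
adjacent-sym (element _) (element _) = refl

adjacent-irrefl : ∀ {m} (a : Vertex m) → adjacent a a ≡ false
adjacent-irrefl centre      = refl
adjacent-irrefl (subset _)  = refl
adjacent-irrefl (element _) = refl

toVertex : ∀ {m} → Fin (suc (pow2 m + m)) → Vertex m
toVertex zero        = centre
toVertex {m} (suc y) = [ subset , element ]′ (splitAt (pow2 m) y)

fromVertex : ∀ {m} → Vertex m → Fin (suc (pow2 m + m))
fromVertex centre          = zero
fromVertex {m} (subset t)  = suc (t ↑ˡ m)
fromVertex {m} (element j) = suc (pow2 m ↑ʳ j)

toVertex-fromVertex : ∀ {m} (a : Vertex m) → toVertex (fromVertex a) ≡ a
toVertex-fromVertex centre                            = refl
toVertex-fromVertex {m} (subset t)  rewrite splitAt-↑ˡ (pow2 m) t m = refl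
toVertex-fromVertex {m} (element j) rewrite splitAt-↑ʳ (pow2 m) m j = refl

fromVertex-toVertex : ∀ {m} (y : Fin (suc (pow2 m + m))) → fromVertex {m} (toVertex y) ≡ y
fromVertex-toVertex zero        = refl
fromVertex-toVertex {m} (suc y) =
  trans (fromVertex-join (splitAt (pow2 m) y)) (cong suc (join-splitAt (pow2 m) m y))
  where
  fromVertex-join : ∀ s → fromVertex {m} ([ subset , element ]′ s) ≡ suc (join (pow2 m) m s)
  fromVertex-join (inj₁ _) = refl
  fromVertex-join (inj₂ _) = refl

toVertex-injective : ∀ {m} → Injective _≡_ _≡_ (toVertex {m})
toVertex-injective {x = y} {y′} eq =
  trans (sym (fromVertex-toVertex y)) (trans (cong fromVertex eq) (fromVertex-toVertex y′))

fromVertex-injective : ∀ {m} → Injective _≡_ _≡_ (fromVertex {m})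
fromVertex-injective {x = a} {a′} eq =
  trans (sym (toVertex-fromVertex a)) (trans (cong toVertex eq) (toVertex-fromVertex a′))

subsetGraph : ℕ → Graph
subsetGraph m = record
  { n      = suc (pow2 m + m)
  ; adj    = λ a b → adjacent (toVertex {m} a) (toVertex {m} b)
  ; sym    = λ a b → adjacent-sym (toVertex {m} a) (toVertex {m} b)
  ; irrefl = λ a → adjacent-irrefl (toVertex {m} a)
  }

edgeProximity : ∀ {m} → Vertex m → Vertex m → Vertex m → Proximity
edgeProximity a b w = proximityOf (does (w ≟ⱽ a) ∨ does (w ≟ⱽ b)) (adjacent w a ∨ adjacent w b)

edgeProximity-SameEnds : ∀ {m} {a b a′ b′ : Vertex m} → SameEnds a b a′ b′ →
                         ∀ w → edgeProximity a b w ≡ edgeProximity a′ b′ w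
edgeProximity-SameEnds (inj₁ (refl , refl)) w = refl
edgeProximity-SameEnds {a = a} {b} (inj₂ (refl , refl)) w =
  cong₂ proximityOf (∨-comm (does (w ≟ⱽ a)) (does (w ≟ⱽ b))) (∨-comm (adjacent w a) (adjacent w b))

does-fromVertex-≟ : ∀ {m} (a : Vertex m) y → does (fromVertex a ≟ y) ≡ does (a ≟ⱽ toVertex y)
does-fromVertex-≟ a y = does-⇔ (mk⇔ (λ { refl → sym (toVertex-fromVertex a) })
                                   (λ { refl → fromVertex-toVertex y }))
                              (fromVertex a ≟ y) (a ≟ⱽ toVertex y)

proximity-subsetGraph : ∀ m u v (a : Vertex m) →
                        proximity (edgeDist (subsetGraph m) u v (fromVertex a))
                        ≡ edgeProximity (toVertex u) (toVertex v) a
proximity-subsetGraph m u v a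
  rewrite proximity-edgeDist (subsetGraph m) u v (fromVertex a)
        | toVertex-fromVertex a
        | does-fromVertex-≟ a u | does-fromVertex-≟ a v = refl

data Edge (m : ℕ) : Set where
  spoke     : Fin (pow2 m) → Edge m
  incidence : (t : Fin (pow2 m)) (j : Fin m) → bit t j ≡ true → Edge m

tail head : ∀ {m} → Edge m → Vertex m
tail (spoke _)           = centre
tail (incidence t _ _)   = subset t
head (spoke t)           = subset t
head (incidence _ j _)   = element j

edge-of : ∀ {m} (a b : Vertex m) → adjacent a b ≡ true →
          Σ (Edge m) λ e → SameEnds a b (tail e) (head e)
edge-of centre      (subset t)  _    = spoke t , inj₁ (refl , refl)
edge-of (subset t)  centre      _    = spoke t , inj₂ (refl , refl)
edge-of (subset t)  (element j) t∋j  = incidence t j t∋j , inj₁ (refl , refl)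
edge-of (element j) (subset t)  t∋j  = incidence t j t∋j , inj₂ (refl , refl)

landmark : ∀ {m} → Fin (suc m) → Vertex m
landmark zero    = centre
landmark (suc j) = element j

incidence-at-own-element : ∀ {m} (t : Fin (pow2 m)) (j : Fin m) →
                           edgeProximity (subset t) (element j) (element j) ≡ at
incidence-at-own-element t j rewrite dec-true (j ≟ j) refl = refl

incidence-at⇒element : ∀ {m} {t : Fin (pow2 m)} {j l : Fin m} →
                       edgeProximity (subset t) (element j) (element l) ≡ at → l ≡ j
incidence-at⇒element {j = j} {l} p with l ≟ j | proximityOf-at p
... | yes l≡j | _ = l≡j

incidence-off-element : ∀ {m} (t : Fin (pow2 m)) {j l : Fin m} → l ≢ j →
                        edgeProximity (subset t) (element j) (element l) ≡ proximityOf false (bit t l)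
incidence-off-element t {j} {l} l≢j rewrite dec-false (l ≟ j) l≢j =
  cong (proximityOf false) (∨-identityʳ (bit t l))

incidence-same-element : ∀ {m} {t t′ : Fin (pow2 m)} {j j′ : Fin m} →
                         (∀ (l : Fin m) → edgeProximity (subset t) (element j) (element l)
                                        ≡ edgeProximity (subset t′) (element j′) (element l)) →
                         j ≡ j′
incidence-same-element {t = t} {t′} {j} {j′} same =
  incidence-at⇒element {t = t′} {j = j′} {l = j}
    (trans (sym (same j)) (incidence-at-own-element t j))

incidence-determined : ∀ {m} {t t′ : Fin (pow2 m)} {j j′ : Fin m} →
                       bit t j ≡ true → bit t′ j′ ≡ true →
                       (∀ (l : Fin m) → edgeProximity (subset t) (element j) (element l)
                                      ≡ edgeProximity (subset t′) (element j′) (element l)) →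
                       t ≡ t′ × j ≡ j′
incidence-determined {t = t} {t′} {j} {j′} t∋j t′∋j′ same
  with refl ← incidence-same-element {t = t} {t′} same
  = bit-injective bits , refl
  where
  bits : ∀ l → bit t l ≡ bit t′ l
  bits l with l ≟ j
  ... | yes refl = trans t∋j (sym t′∋j′)
  ... | no l≢j   = proximityOf-false-injective
    (trans (sym (incidence-off-element t l≢j)) (trans (same l) (incidence-off-element t′ l≢j)))

edge-determined : ∀ {m} (e e′ : Edge m) →
                  (∀ ℓ → edgeProximity (tail e) (head e) (landmark ℓ)
                       ≡ edgeProximity (tail e′) (head e′) (landmark ℓ)) →
                  tail e ≡ tail e′ × head e ≡ head e′
edge-determined (spoke t) (spoke t′) same =
  refl , cong subset (bit-injective λ j → proximityOf-false-injective (same (suc j)))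
edge-determined (spoke _) (incidence _ _ _) same with () ← same zero
edge-determined (incidence _ _ _) (spoke _) same with () ← same zero
edge-determined (incidence t j t∋j) (incidence t′ j′ t′∋j′) same
  with incidence-determined {t = t} {t′} t∋j t′∋j′ (same ∘ suc)
... | refl , refl = refl , refl

subsetLandmarks : ∀ m → Fin (suc m) → Fin (n (subsetGraph m))
subsetLandmarks m = fromVertex ∘ landmark

subsetLandmarks-injective : ∀ m → Injective _≡_ _≡_ (subsetLandmarks m)
subsetLandmarks-injective m = landmark-injective ∘ fromVertex-injective
  where
  landmark-injective : Injective _≡_ _≡_ (landmark {m})
  landmark-injective {zero}  {zero}  _  = refl
  landmark-injective {suc _} {suc _} eq = cong suc (element-injective eq)

subsetLandmarks-resolving : ∀ m → IsEdgeResolving (subsetGraph m) (subsetLandmarks m)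
subsetLandmarks-resolving m u v u′ v′ u~v u′~v′ same
  with edge-of (toVertex u) (toVertex v) u~v | edge-of (toVertex u′) (toVertex v′) u′~v′
... | e , uv≐e | e′ , u′v′≐e′ =
  SameEnds-injective toVertex-injective
    (SameEnds-trans uv≐e
      (SameEnds-trans (inj₁ (edge-determined e e′ same-proximities)) (SameEnds-sym u′v′≐e′)))
  where
  same-proximities : ∀ ℓ → edgeProximity (tail e) (head e) (landmark ℓ)
                         ≡ edgeProximity (tail e′) (head e′) (landmark ℓ)
  same-proximities ℓ = begin
    edgeProximity (tail e) (head e) w                        ≡⟨ edgeProximity-SameEnds uv≐e w ⟨
    edgeProximity (toVertex u) (toVertex v) w                ≡⟨ proximity-subsetGraph m u v w ⟨
    proximity (edgeDist (subsetGraph m) u v (fromVertex w))   ≡⟨ cong proximity (same ℓ) ⟩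
    proximity (edgeDist (subsetGraph m) u′ v′ (fromVertex w)) ≡⟨ proximity-subsetGraph m u′ v′ w ⟩
    edgeProximity (toVertex u′) (toVertex v′) w              ≡⟨ edgeProximity-SameEnds u′v′≐e′ w ⟩
    edgeProximity (tail e′) (head e′) w                      ∎
    where
    open ≡-Reasoning
    w = landmark ℓ

length-filterᵇ-tabulate : ∀ {X : Set} a b (f : Fin (a + b) → X) (p : X → Bool) →
                          (∀ i → p (f (i ↑ˡ b)) ≡ true) → (∀ j → p (f (a ↑ʳ j)) ≡ false) →
                          length (filterᵇ p (tabulate f)) ≡ a
length-filterᵇ-tabulate zero    zero    f p _    _     = refl
length-filterᵇ-tabulate zero    (suc b) f p _    right rewrite right zero =
  length-filterᵇ-tabulate zero b (f ∘ suc) p (λ ()) (right ∘ suc)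
length-filterᵇ-tabulate (suc a) b       f p left right rewrite left zero =
  cong suc (length-filterᵇ-tabulate a b (f ∘ suc) p (left ∘ suc) right)

degree-centre : ∀ m → degree (subsetGraph m) (subsetLandmarks m zero) ≡ pow2 m
degree-centre m =
  length-filterᵇ-tabulate (pow2 m) m suc (λ y → adjacent centre (toVertex {m} y)) subsets elements
  where
  subsets : ∀ i → adjacent centre (toVertex {m} (suc (i ↑ˡ m))) ≡ true
  subsets i rewrite splitAt-↑ˡ (pow2 m) i m = refl
  elements : ∀ j → adjacent centre (toVertex {m} (suc (pow2 m ↑ʳ j))) ≡ false
  elements j rewrite splitAt-↑ʳ (pow2 m) m j = refl

theorem10 : ((G : Graph) (k : ℕ) (S : Fin k → Fin (n G)) → 1 ≤ k →
                Injective _≡_ _≡_ S → IsEdgeResolving G S →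
                ∀ i → degree G (S i) ≤ 2 ^ (k ∸ 1))
              × ((k : ℕ) → 1 ≤ k →
                Σ Graph λ G → Σ (Fin k → Fin (n G)) λ S →
                  Injective _≡_ _≡_ S × IsEdgeResolving G S ×
                  ∃ λ i → degree G (S i) ≡ 2 ^ (k ∸ 1))
theorem10 = (λ { G (suc m) S _ _ resolving → degree≤2^ G S resolving })
          , λ { (suc m) _ → subsetGraph m , subsetLandmarks m
                          , subsetLandmarks-injective m , subsetLandmarks-resolving m
                          , zero , trans (degree-centre m) (pow2≡2^ m) }
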